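{- Let $r\ge 2$. For every $n\ge 2r$, the set $\mathcal{T}_n(1)$ is a maximal (inclusion-wise) independent set of $H_{n:r}$. For every $n\ge r^2$, the set $\Big(\bigcup_{i=r^2+1}^{n}\mathcal{H}_i(i)\Big)\cup\mathcal{T}_{r^2}(1)$ is a maximal independent set of $H_{n:r}$.
   Context: For positive integers $n,r$ write $[n]=\{1,\dots,n\}$. The Häggkvist–Hell graph $H_{n:r}$ is the graph whose vertices are the ordered pairs $(h,T)$ where $T$ is an $r$-element subset of $[n]$ and $h\in[n]\setminus T$; two vertices $(h_x,T_x)$ and $(h_y,T_y)$ are adjacent iff $h_x\in T_y$, $h_y\in T_x$ and $T_x\cap T_y=\varnothing$. For $i\le n$, $H_{i:r}$ is viewed as the induced subgraph of $H_{n:r}$ on vertices using only elements of $[i]$. Define $\mathcal{H}_i(j)=\{(h,T)\in V(H_{i:r}): h=j\}$ and $\mathcal{T}_i(j)=\{(h,T)\in V(H_{i:r}): j\in T\}$. -}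

module Defs where

open import Data.Nat using (ℕ; suc; _≤_; _*_)
open import Data.Fin using (Fin; toℕ)
open import Data.Fin.Subset using (Subset; _∈_; _∉_; ∣_∣)
open import Data.Product using (Σ; _×_)
open import Data.Sum using (_⊎_)
open import Data.Empty using (⊥)
open import Relation.Binary.PropositionalEquality using (_≡_)
open import Relation.Nullary using (¬_)

-- Ground set [n] = {1,…,n} is represented by Fin n; the index k : Fin n
-- stands for the element  label k = toℕ k + 1.
label : {n : ℕ} → Fin n → ℕ
label k = suc (toℕ k)

record Vertex (n r : ℕ) : Set where
  constructor vtx
  field
    head  : Fin n
    tail  : Subset n
    size  : ∣ tail ∣ ≡ r
    h∉T   : head ∉ tail
open Vertex public

Adj : {n r : ℕ} → Vertex n r → Vertex n r → Set
Adj x y = (head x ∈ tail y) × (head y ∈ tail x)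
        × (∀ k → k ∈ tail x → k ∈ tail y → ⊥)

VSet : ℕ → ℕ → Set₁
VSet n r = Vertex n r → Set

_⊆V_ : {n r : ℕ} → VSet n r → VSet n r → Set
S ⊆V S' = ∀ v → S v → S' v

Independent : {n r : ℕ} → VSet n r → Set
Independent S = ∀ x y → S x → S y → ¬ Adj x y

MaximalIndependent : {n r : ℕ} → VSet n r → Set₁
MaximalIndependent {n} {r} S =
  Independent S × (∀ (S' : VSet n r) → Independent S' → S ⊆V S' → S' ⊆V S)

-- v is a vertex of the induced subgraph H_{i:r} (uses only elements of [i]).
InH : {n r : ℕ} → ℕ → Vertex n r → Set
InH i v = (label (head v) ≤ i) × (∀ k → k ∈ tail v → label k ≤ i)

𝓗 : {n r : ℕ} → ℕ → ℕ → VSet n r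
𝓗 i j v = InH i v × (label (head v) ≡ j)

𝓣 : {n r : ℕ} → ℕ → ℕ → VSet n r
𝓣 i j v = InH i v × Σ (Fin _) (λ k → (k ∈ tail v) × (label k ≡ j))

BigSet : (n r : ℕ) → VSet n r
BigSet n r v =
  Σ ℕ (λ i → (suc (r * r) ≤ i) × (i ≤ n) × 𝓗 i i v) ⊎ 𝓣 (r * r) 1 v

module Submission where

-- Call a set S of vertices *dominating* if every vertex lies in S
-- or is adjacent to a member of S; an independent dominating set is maximal
-- independent.  Both parts of the theorem are therefore reduced to domination.
--
-- The engine is one construction: given a vertex v = (h,T), an element p ∈ T
-- and a set A ⊇ {h} disjoint from T with |A| ≤ r, fill A up to an r-set T'
-- with elements of [b] ∖ (T ∪ A) (possible as soon as 2r ≤ b); then (p,T')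
-- is a vertex adjacent to v.
--   * Part 1: for v ∈ H_{N:r} (N ≥ 2r) with 1 ∉ T, take A = {1,h} and b = N;
--     the new vertex lies in 𝓣_N(1).  So 𝓣_N(1) dominates H_{N:r}.
--   * Part 2: let t be the largest element used by v.  If t ≤ r² use Part 1
--     with N = r²; if t = h then v ∈ 𝓗_t(t); otherwise t ∈ T and A = {h},
--     b = t − 1 ≥ r² ≥ 2r give a neighbour of v in 𝓗_t(t).
-- Independence is direct: two members of 𝓣_N(1) share 1, two members of
-- ⋃ 𝓗_i(i) would need the same head, and 𝓗_i(i) (i > r²) meets no 𝓣_{r²}(1).

open import Defs
open import Data.Nat using (ℕ; zero; suc; _+_; _*_; _∸_; _≤_; _<_; z≤n; s≤s; s≤s⁻¹; _≤?_)
open import Data.Nat.Properties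
open import Data.Product using (Σ-syntax; _×_; _,_; proj₁)
open import Data.Sum using (_⊎_; inj₁; inj₂; [_,_]; map₂)
open import Data.Empty using (⊥-elim)
open import Data.Bool using (true; false)
open import Data.Vec using ([]; _∷_; here; there)
open import Data.Fin using (Fin; toℕ) renaming (zero to fzero; suc to fsuc)
open import Data.Fin.Properties using (toℕ<n; toℕ-injective)
open import Data.Fin.Subset using (Subset; _∈_; _∉_; _⊆_; ∣_∣; _∪_; ⁅_⁆; Nonempty) renaming (⊥ to ∅)
open import Data.Fin.Subset.Properties
  using (_∈?_; nonempty?; Empty-unique; ∣⊥∣≡0; ∉⊥; x∈⁅x⁆; x∈⁅y⁆⇒x≡y; ∣⁅x⁆∣≡1; x∈p∪q⁻; x∈p∪q⁺)
open import Relation.Binary.PropositionalEquality using (_≡_; refl; sym; trans; cong; cong₂; subst; module ≡-Reasoning)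
open import Relation.Nullary using (¬_; yes; no; contradiction)

Disjoint : ∀ {n} → Subset n → Subset n → Set
Disjoint p q = ∀ i → i ∈ p → i ∉ q

Disjoint-∪ : ∀ {n} {p q s : Subset n} → Disjoint p s → Disjoint q s → Disjoint (p ∪ q) s
Disjoint-∪ {p = p} {q} p#s q#s i i∈p∪q = [ p#s i , q#s i ] (x∈p∪q⁻ p q i∈p∪q)

⁅⁆-disjoint : ∀ {n} {x : Fin n} {p : Subset n} → x ∉ p → Disjoint ⁅ x ⁆ p
⁅⁆-disjoint {x = x} {p} x∉p k k∈⁅x⁆ k∈p = x∉p (subst (_∈ p) (x∈⁅y⁆⇒x≡y x k∈⁅x⁆) k∈p)

Disjoint-∷⁻ : ∀ {n} {x y} {p q : Subset n} → Disjoint (x ∷ p) (y ∷ q) → Disjoint p q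
Disjoint-∷⁻ xp#yq i i∈p i∈q = xp#yq (fsuc i) (there i∈p) (there i∈q)

∣p∪q∣≤∣p∣+∣q∣ : ∀ {n} (p q : Subset n) → ∣ p ∪ q ∣ ≤ ∣ p ∣ + ∣ q ∣
∣p∪q∣≤∣p∣+∣q∣ [] [] = z≤n
∣p∪q∣≤∣p∣+∣q∣ (true ∷ p) (true ∷ q) = s≤s (≤-trans (∣p∪q∣≤∣p∣+∣q∣ p q) (+-monoʳ-≤ ∣ p ∣ (n≤1+n ∣ q ∣)))
∣p∪q∣≤∣p∣+∣q∣ (true ∷ p) (false ∷ q) = s≤s (∣p∪q∣≤∣p∣+∣q∣ p q)
∣p∪q∣≤∣p∣+∣q∣ (false ∷ p) (true ∷ q) rewrite +-suc ∣ p ∣ ∣ q ∣ = s≤s (∣p∪q∣≤∣p∣+∣q∣ p q)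
∣p∪q∣≤∣p∣+∣q∣ (false ∷ p) (false ∷ q) = ∣p∪q∣≤∣p∣+∣q∣ p q

∣p∪q∣-disjoint : ∀ {n} (p q : Subset n) → Disjoint p q → ∣ p ∪ q ∣ ≡ ∣ p ∣ + ∣ q ∣
∣p∪q∣-disjoint [] [] _ = refl
∣p∪q∣-disjoint (true ∷ p) (true ∷ q) p#q = contradiction here (p#q fzero here)
∣p∪q∣-disjoint (true ∷ p) (false ∷ q) p#q =
  cong suc (∣p∪q∣-disjoint p q (Disjoint-∷⁻ p#q))
∣p∪q∣-disjoint (false ∷ p) (true ∷ q) p#q =
  trans (cong suc (∣p∪q∣-disjoint p q (Disjoint-∷⁻ p#q))) (sym (+-suc ∣ p ∣ ∣ q ∣))
∣p∪q∣-disjoint (false ∷ p) (false ∷ q) p#q =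
  ∣p∪q∣-disjoint p q (Disjoint-∷⁻ p#q)

nonempty-of-size : ∀ {n} (p : Subset n) → 0 < ∣ p ∣ → Nonempty p
nonempty-of-size {n} p 0<∣p∣ with nonempty? p
... | yes ne = ne
... | no empty = ⊥-elim (<-irrefl (sym (trans (cong ∣_∣ (Empty-unique empty)) (∣⊥∣≡0 n))) 0<∣p∣)

largest : ∀ {n} (p : Subset n) → Nonempty p →
  Σ[ t ∈ Fin n ] t ∈ p × (∀ j → j ∈ p → toℕ j ≤ toℕ t)
largest (x ∷ p) ne with nonempty? p
largest (x ∷ p) ne | yes ne-p with largest p ne-p
... | t , t∈p , t-max = fsuc t , there t∈p , max
  where
  max : ∀ j → j ∈ (x ∷ p) → toℕ j ≤ toℕ (fsuc t)
  max fzero _ = z≤n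
  max (fsuc j) (there j∈p) = s≤s (t-max j j∈p)
largest (x ∷ p) (fzero , 0∈) | no empty-p = fzero , 0∈ , max
  where
  max : ∀ j → j ∈ (x ∷ p) → toℕ j ≤ 0
  max fzero _ = z≤n
  max (fsuc j) (there j∈p) = ⊥-elim (empty-p (j , j∈p))
largest (x ∷ p) (fsuc j , there j∈p) | no empty-p = ⊥-elim (empty-p (j , j∈p))

fresh : ∀ {n} (S : Subset n) (k b : ℕ) → k + ∣ S ∣ ≤ b → b ≤ n →
  Σ[ Q ∈ Subset n ] ∣ Q ∣ ≡ k × Disjoint Q S × (∀ i → i ∈ Q → label i ≤ b)
fresh {n} S zero b _ _ = ∅ , ∣⊥∣≡0 n , (λ i i∈∅ → contradiction i∈∅ ∉⊥) , (λ i i∈∅ → contradiction i∈∅ ∉⊥)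
fresh (true ∷ S) (suc k) (suc b) room (s≤s b≤n)
  with fresh S (suc k) b (s≤s⁻¹ (subst (_≤ suc b) (+-suc (suc k) ∣ S ∣) room)) b≤n
... | Q , ∣Q∣ , Q#S , Q≤b = false ∷ Q , ∣Q∣ , Q#S′ , Q≤b′
  where
  Q#S′ : Disjoint (false ∷ Q) (true ∷ S)
  Q#S′ (fsuc i) (there i∈Q) (there i∈S) = Q#S i i∈Q i∈S
  Q≤b′ : ∀ i → i ∈ (false ∷ Q) → label i ≤ suc b
  Q≤b′ (fsuc i) (there i∈Q) = s≤s (Q≤b i i∈Q)
fresh (false ∷ S) (suc k) (suc b) (s≤s room) (s≤s b≤n) with fresh S k b room b≤n
... | Q , ∣Q∣ , Q#S , Q≤b = true ∷ Q , cong suc ∣Q∣ , Q#S′ , Q≤b′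
  where
  Q#S′ : Disjoint (true ∷ Q) (false ∷ S)
  Q#S′ (fsuc i) (there i∈Q) (there i∈S) = Q#S i i∈Q i∈S
  Q≤b′ : ∀ i → i ∈ (true ∷ Q) → label i ≤ suc b
  Q≤b′ fzero here = s≤s z≤n
  Q≤b′ (fsuc i) (there i∈Q) = s≤s (Q≤b i i∈Q)

-- (r − a) + (a + r) = 2r: the room needed to complete an a-set to an r-set
-- while avoiding a further r-set.
completion-count : ∀ r a → a ≤ r → (r ∸ a) + (a + r) ≡ 2 * r
completion-count r a a≤r = begin
  (r ∸ a) + (a + r)  ≡⟨ sym (+-assoc (r ∸ a) a r) ⟩
  (r ∸ a + a) + r    ≡⟨ cong (_+ r) (m∸n+n≡m a≤r) ⟩
  r + r              ≡⟨ cong (r +_) (sym (+-identityʳ r)) ⟩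
  2 * r              ∎
  where open ≡-Reasoning

Adj-sym : ∀ {n r} {x y : Vertex n r} → Adj x y → Adj y x
Adj-sym (hx∈Ty , hy∈Tx , Tx#Ty) = hy∈Tx , hx∈Ty , λ k k∈Ty k∈Tx → Tx#Ty k k∈Tx k∈Ty

neighbour : ∀ {n r} (v : Vertex n r) {p : Fin n} → p ∈ tail v →
  (A : Subset n) → head v ∈ A → Disjoint A (tail v) → ∣ A ∣ ≤ r →
  (b : ℕ) → 2 * r ≤ b → b ≤ n →
  Σ[ w ∈ Vertex n r ] head w ≡ p × Adj v w × A ⊆ tail w
                    × (∀ k → k ∈ tail w → k ∈ A ⊎ label k ≤ b)
neighbour {n} {r} v {p} p∈T A h∈A A#T ∣A∣≤r b 2r≤b b≤n = complete (fresh (A ∪ tail v) (r ∸ ∣ A ∣) b room b≤n)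
  where
  room : (r ∸ ∣ A ∣) + ∣ A ∪ tail v ∣ ≤ b
  room = ≤-trans (≤-reflexive (begin
    (r ∸ ∣ A ∣) + ∣ A ∪ tail v ∣       ≡⟨ cong ((r ∸ ∣ A ∣) +_) (∣p∪q∣-disjoint A (tail v) A#T) ⟩
    (r ∸ ∣ A ∣) + (∣ A ∣ + ∣ tail v ∣) ≡⟨ cong (λ s → (r ∸ ∣ A ∣) + (∣ A ∣ + s)) (size v) ⟩
    (r ∸ ∣ A ∣) + (∣ A ∣ + r)          ≡⟨ completion-count r ∣ A ∣ ∣A∣≤r ⟩
    2 * r                              ∎)) 2r≤b
    where open ≡-Reasoning
  complete : Σ[ Q ∈ Subset n ] ∣ Q ∣ ≡ r ∸ ∣ A ∣ × Disjoint Q (A ∪ tail v) × (∀ i → i ∈ Q → label i ≤ b) →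
    Σ[ w ∈ Vertex n r ] head w ≡ p × Adj v w × A ⊆ tail w × (∀ k → k ∈ tail w → k ∈ A ⊎ label k ≤ b)
  complete (Q , ∣Q∣ , Q#A∪T , Q≤b) = vtx p (A ∪ Q) ∣A∪Q∣ p∉A∪Q , refl , adj , (λ k∈A → x∈p∪q⁺ (inj₁ k∈A)) , within
    where
    A#Q : Disjoint A Q
    A#Q i i∈A i∈Q = Q#A∪T i i∈Q (x∈p∪q⁺ (inj₁ i∈A))
    A∪Q#T : Disjoint (A ∪ Q) (tail v)
    A∪Q#T = Disjoint-∪ A#T (λ i i∈Q i∈T → Q#A∪T i i∈Q (x∈p∪q⁺ (inj₂ i∈T)))
    ∣A∪Q∣ : ∣ A ∪ Q ∣ ≡ r
    ∣A∪Q∣ = trans (∣p∪q∣-disjoint A Q A#Q) (trans (cong (∣ A ∣ +_) ∣Q∣) (m+[n∸m]≡n ∣A∣≤r))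
    p∉A∪Q : p ∉ A ∪ Q
    p∉A∪Q p∈A∪Q = A∪Q#T p p∈A∪Q p∈T
    adj : Adj v (vtx p (A ∪ Q) ∣A∪Q∣ p∉A∪Q)
    adj = x∈p∪q⁺ (inj₁ h∈A) , p∈T , λ k k∈T k∈A∪Q → A∪Q#T k k∈A∪Q k∈T
    within : ∀ k → k ∈ A ∪ Q → k ∈ A ⊎ label k ≤ b
    within k k∈A∪Q = map₂ (Q≤b k) (x∈p∪q⁻ A Q k∈A∪Q)

bounded : ∀ {n} {T A : Subset n} {b i : ℕ} → (∀ k → k ∈ T → k ∈ A ⊎ label k ≤ b) →
  (∀ k → k ∈ A → label k ≤ i) → b ≤ i → ∀ k → k ∈ T → label k ≤ i
bounded T⊆A∪[b] A≤i b≤i k k∈T = [ A≤i k , (λ k≤b → ≤-trans k≤b b≤i) ] (T⊆A∪[b] k k∈T)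

⁅⁆-bounded : ∀ {n} {x : Fin n} {i : ℕ} → label x ≤ i → ∀ k → k ∈ ⁅ x ⁆ → label k ≤ i
⁅⁆-bounded {x = x} {i} x≤i k k∈⁅x⁆ = subst (λ y → label y ≤ i) (sym (x∈⁅y⁆⇒x≡y x k∈⁅x⁆)) x≤i

label-injective : ∀ {n} {a b : Fin n} → label a ≡ label b → a ≡ b
label-injective eq = toℕ-injective (suc-injective eq)

Dominated : ∀ {n r} → VSet n r → Vertex n r → Set
Dominated {n} {r} S v = S v ⊎ Σ[ w ∈ Vertex n r ] S w × Adj v w

dominated-mono : ∀ {n r} {S S′ : VSet n r} {v : Vertex n r} → S ⊆V S′ → Dominated S v → Dominated S′ v
dominated-mono S⊆S′ (inj₁ v∈S) = inj₁ (S⊆S′ _ v∈S)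
dominated-mono S⊆S′ (inj₂ (w , w∈S , adj)) = inj₂ (w , S⊆S′ w w∈S , adj)

-- An independent set dominating every vertex is maximal: a vertex added to it
-- would be adjacent to one of its members.
maximal-if-dominating : ∀ {n r} {S : VSet n r} → Independent S → (∀ v → Dominated S v) → MaximalIndependent S
maximal-if-dominating {S = S} indS dom = indS , maximal
  where
  maximal : ∀ S′ → Independent S′ → S ⊆V S′ → S′ ⊆V S
  maximal S′ indS′ S⊆S′ v v∈S′ with dom v
  ... | inj₁ v∈S = v∈S
  ... | inj₂ (w , w∈S , adj) = ⊥-elim (indS′ v w v∈S′ (S⊆S′ w w∈S) adj)

tail-nonempty : ∀ {n r} → 1 ≤ r → (v : Vertex n r) → Nonempty (tail v)
tail-nonempty r≥1 v = nonempty-of-size (tail v) (subst (0 <_) (sym (size v)) r≥1)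

-- Part 1: two members of 𝓣_N(1) both contain 1, so they are never adjacent.
𝓣-independent : ∀ {n r} (N : ℕ) → Independent {n} {r} (𝓣 N 1)
𝓣-independent N x y (_ , k , k∈Tx , k≡1) (_ , k′ , k′∈Ty , k′≡1) (_ , _ , Tx#Ty) =
  Tx#Ty k k∈Tx (subst (_∈ tail y) (label-injective (trans k′≡1 (sym k≡1))) k′∈Ty)

-- Part 1: for 2r ≤ N, 𝓣_N(1) dominates H_{N:r}.  A vertex v = (h,T) with 1 ∉ T
-- is joined to (p, T') for any p ∈ T, by completing A = {1,h} inside [N].
𝓣-dominates : ∀ {n r N} → 2 ≤ r → 2 * r ≤ N → N ≤ n → (v : Vertex n r) → InH N v → Dominated (𝓣 N 1) v
𝓣-dominates {zero} _ _ _ v _ with head v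
... | ()
𝓣-dominates {suc m} {r} {N} r≥2 2r≤N N≤n v v∈H@(h≤N , T≤N) with fzero ∈? tail v
... | yes 1∈T = inj₁ (v∈H , fzero , 1∈T , refl)
... | no 1∉T = inj₂ (new-neighbour (tail-nonempty (≤-trans (s≤s z≤n) r≥2) v))
  where
  A : Subset (suc m)
  A = ⁅ fzero ⁆ ∪ ⁅ head v ⁆
  h∈A : head v ∈ A
  h∈A = x∈p∪q⁺ (inj₂ (x∈⁅x⁆ (head v)))
  A#T : Disjoint A (tail v)
  A#T = Disjoint-∪ (⁅⁆-disjoint 1∉T) (⁅⁆-disjoint (h∉T v))
  ∣A∣≤r : ∣ A ∣ ≤ r
  ∣A∣≤r = ≤-trans (∣p∪q∣≤∣p∣+∣q∣ ⁅ fzero ⁆ ⁅ head v ⁆)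
                  (≤-trans (≤-reflexive (cong₂ _+_ (∣⁅x⁆∣≡1 {suc m} fzero) (∣⁅x⁆∣≡1 (head v)))) r≥2)
  A≤N : ∀ k → k ∈ A → label k ≤ N
  A≤N k k∈A = [ ⁅⁆-bounded (≤-trans (s≤s z≤n) h≤N) k , ⁅⁆-bounded h≤N k ] (x∈p∪q⁻ ⁅ fzero ⁆ ⁅ head v ⁆ k∈A)
  new-neighbour : Nonempty (tail v) → Σ[ w ∈ Vertex (suc m) r ] 𝓣 N 1 w × Adj v w
  new-neighbour (p , p∈T) with neighbour v p∈T A h∈A A#T ∣A∣≤r N 2r≤N N≤n
  ... | w , _ , adj@(_ , hw∈T , _) , A⊆Tw , Tw⊆A∪[N] =
    w , ((T≤N (head w) hw∈T , bounded Tw⊆A∪[N] A≤N ≤-refl) , fzero , A⊆Tw (x∈p∪q⁺ (inj₁ (x∈⁅x⁆ fzero))) , refl) , adj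

high-head-not-adjacent : ∀ {n r} (x y : Vertex n r) → r * r < label (head x) → InH (r * r) y → ¬ Adj x y
high-head-not-adjacent x y r²<hx (_ , Ty≤r²) (hx∈Ty , _) = <⇒≱ r²<hx (Ty≤r² (head x) hx∈Ty)

-- Adjacent x ∈ 𝓗_i(i), y ∈ 𝓗_j(j) give i ≤ j
-- (h_x ∈ T_y) and j ≤ i, hence h_x = h_y ∈ T_y, which is impossible; the
-- mixed cases are excluded by high-head-not-adjacent.
BigSet-independent : ∀ {n r} → Independent (BigSet n r)
BigSet-independent x y (inj₁ (i , _ , _ , (_ , Tx≤i) , hx≡i)) (inj₁ (j , _ , _ , (_ , Ty≤j) , hy≡j)) (hx∈Ty , hy∈Tx , _) =
  h∉T y (subst (_∈ tail y) (label-injective hx≡hy) hx∈Ty)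
  where
  i≡j : i ≡ j
  i≡j = ≤-antisym (subst (_≤ j) hx≡i (Ty≤j (head x) hx∈Ty)) (subst (_≤ i) hy≡j (Tx≤i (head y) hy∈Tx))
  hx≡hy : label (head x) ≡ label (head y)
  hx≡hy = trans hx≡i (trans i≡j (sym hy≡j))
BigSet-independent {r = r} x y (inj₁ (i , r²<i , _ , _ , hx≡i)) (inj₂ (y∈H , _)) adj =
  high-head-not-adjacent x y (subst (r * r <_) (sym hx≡i) r²<i) y∈H adj
BigSet-independent {r = r} x y (inj₂ (x∈H , _)) (inj₁ (j , r²<j , _ , _ , hy≡j)) adj =
  high-head-not-adjacent y x (subst (r * r <_) (sym hy≡j) r²<j) x∈H (Adj-sym {x = x} {y} adj)
BigSet-independent {r = r} x y (inj₂ x∈𝓣) (inj₂ y∈𝓣) adj = 𝓣-independent (r * r) x y x∈𝓣 y∈𝓣 adj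

used : ∀ {n r} → Vertex n r → Subset n
used v = tail v ∪ ⁅ head v ⁆

head-used : ∀ {n r} (v : Vertex n r) → head v ∈ used v
head-used v = x∈p∪q⁺ (inj₂ (x∈⁅x⁆ (head v)))

InH-of-used : ∀ {n r} {i : ℕ} (v : Vertex n r) → (∀ k → k ∈ used v → label k ≤ i) → InH i v
InH-of-used v used≤i = used≤i (head v) (head-used v) , λ k k∈T → used≤i k (x∈p∪q⁺ (inj₁ k∈T))

𝓗-in-BigSet : ∀ {n r} (t : Fin n) (w : Vertex n r) → r * r < label t → InH (label t) w →
  label (head w) ≡ label t → BigSet n r w
𝓗-in-BigSet t w r²<t w∈H hw≡t = inj₁ (label t , r²<t , toℕ<n t , w∈H , hw≡t)

-- Part 2, main case: the largest element t used by v exceeds r².  Either t is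
-- the head of v, so v ∈ 𝓗_t(t), or t ∈ T and completing {h} inside [t−1]
-- gives a neighbour (t,T') ∈ 𝓗_t(t).
large-top-dominated : ∀ {n r} → 2 ≤ r → (v : Vertex n r) (t : Fin n) → t ∈ used v →
  InH (label t) v → r * r < label t → Dominated (BigSet n r) v
large-top-dominated {r = r} r≥2 v t t∈used v∈H r²<t with x∈p∪q⁻ (tail v) ⁅ head v ⁆ t∈used
... | inj₂ t∈⁅h⁆ = inj₁ (𝓗-in-BigSet t v r²<t v∈H (cong label (sym (x∈⁅y⁆⇒x≡y (head v) t∈⁅h⁆))))
... | inj₁ t∈T with neighbour v t∈T ⁅ head v ⁆ (x∈⁅x⁆ (head v)) (⁅⁆-disjoint (h∉T v)) ∣⁅h⁆∣≤r (toℕ t) 2r≤t (<⇒≤ (toℕ<n t))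
  where
  ∣⁅h⁆∣≤r : ∣ ⁅ head v ⁆ ∣ ≤ r
  ∣⁅h⁆∣≤r = ≤-trans (≤-reflexive (∣⁅x⁆∣≡1 (head v))) (≤-trans (s≤s z≤n) r≥2)
  2r≤t : 2 * r ≤ toℕ t
  2r≤t = ≤-trans (*-monoˡ-≤ r r≥2) (s≤s⁻¹ r²<t)
... | w , hw≡t , adj , _ , Tw⊆⁅h⁆∪[t] =
  inj₂ (w , 𝓗-in-BigSet t w r²<t w∈H (cong label hw≡t) , adj)
  where
  w∈H : InH (label t) w
  w∈H = ≤-reflexive (cong label hw≡t) , bounded Tw⊆⁅h⁆∪[t] (⁅⁆-bounded (proj₁ v∈H)) (n≤1+n (toℕ t))

-- Part 2: BigSet dominates every vertex, by case analysis on the largest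
-- element t used by v; if t ≤ r² then v ∈ H_{r²:r} and Part 1 applies.
BigSet-dominates : ∀ {n r} → 2 ≤ r → r * r ≤ n → (v : Vertex n r) → Dominated (BigSet n r) v
BigSet-dominates {n} {r} r≥2 r²≤n v with largest (used v) (head v , head-used v)
... | t , t∈used , t-max with label t ≤? r * r
...   | yes t≤r² = dominated-mono {S = 𝓣 (r * r) 1} {BigSet n r} {v} (λ _ → inj₂)
        (𝓣-dominates r≥2 (*-monoˡ-≤ r r≥2) r²≤n v (InH-of-used v (λ k k∈used → ≤-trans (s≤s (t-max k k∈used)) t≤r²)))
...   | no t≰r² = large-top-dominated r≥2 v t t∈used (InH-of-used v (λ k k∈used → s≤s (t-max k k∈used))) (≰⇒> t≰r²)

InH-all : ∀ {n r} (v : Vertex n r) → InH n v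
InH-all v = toℕ<n (head v) , λ k _ → toℕ<n k

mainTheorem14 : (r : ℕ) → 2 ≤ r →
    ((n : ℕ) → 2 * r ≤ n → MaximalIndependent {n} {r} (𝓣 n 1))
    × ((n : ℕ) → r * r ≤ n → MaximalIndependent {n} {r} (BigSet n r))
mainTheorem14 r r≥2 = part₁ , part₂
  where
  part₁ : (n : ℕ) → 2 * r ≤ n → MaximalIndependent {n} {r} (𝓣 n 1)
  part₁ n 2r≤n = maximal-if-dominating (𝓣-independent n) (λ v → 𝓣-dominates r≥2 2r≤n ≤-refl v (InH-all v))
  part₂ : (n : ℕ) → r * r ≤ n → MaximalIndependent {n} {r} (BigSet n r)
  part₂ n r²≤n = maximal-if-dominating BigSet-independent (BigSet-dominates r≥2 r²≤n)
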